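{- The binary Golay code $G_{23}$ and the extended binary Golay code $G_{24}$ are $\mathbb{Z}_2\mathbb{Z}_2[u]$-linear codes. Moreover, the parameters $(\alpha,\beta)$ with $\beta>0$ for which they are $\mathbb{Z}_2\mathbb{Z}_2[u]$-linear are exactly: (i) $(0,12)$ and $(8,8)$ for $G_{24}$; (ii) $(7,8)$ for $G_{23}$.
   Context: $G_{23}$ is the binary $[23,12,7]$ perfect Golay code and $G_{24}$ its extension by an overall parity bit, a $[24,12,8]$ code. Let $\mathbb{Z}_2[u]=\{0,1,u,1+u\}$ be the ring with $u^2=0$, $\pi:\mathbb{Z}_2[u]\to\mathbb{Z}_2$ with $\pi(0)=\pi(u)=0$, $\pi(1)=\pi(1+u)=1$. $\mathbb{Z}_2^\alpha\times\mathbb{Z}_2[u]^\beta$ is a $\mathbb{Z}_2[u]$-module with componentwise addition and scalar multiplication $\lambda(x_1,\dots,x_\alpha\mid x'_1,\dots,x'_\beta)=(\pi(\lambda)x_1,\dots,\pi(\lambda)x_\alpha\mid\lambda x'_1,\dots,\lambda x'_\beta)$; a $\mathbb{Z}_2\mathbb{Z}_2[u]$-additive code with parameters $(\alpha,\beta)$ is a $\mathbb{Z}_2[u]$-submodule of it. $\psi:\mathbb{Z}_2[u]\to\mathbb{Z}_2^2$ is $\psi(0)=(0,0)$, $\psi(1)=(0,1)$, $\psi(u)=(1,1)$, $\psi(1+u)=(1,0)$, extended coordinatewise, and $\Psi(x\mid x')=(x\mid\psi(x'))$. A binary code $C$ of length $\alpha+2\beta$ is $\mathbb{Z}_2\mathbb{Z}_2[u]$-linear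 with parameters $(\alpha,\beta)$ if, after a suitable permutation of coordinates, $C=\Psi(\mathcal{C})$ for a $\mathbb{Z}_2\mathbb{Z}_2[u]$-additive code $\mathcal{C}$ with parameters $(\alpha,\beta)$. -}

module Defs where

open import Level using (0ℓ)
open import Data.Bool using (Bool; true; false; _∧_; _xor_; if_then_else_)
open import Data.Nat using (ℕ; zero; suc; _+_; _*_; _∸_; _≤ᵇ_)
open import Data.Fin using (Fin; toℕ)
open import Data.Vec using (Vec; []; _∷_; tabulate; lookup; zipWith; replicate; foldr′; map; _++_; concat)
open import Data.List using (List; []; _∷_)
open import Data.Product using (Σ; _×_; _,_; ∃)
open import Function.Bundles using (_↔_; _⇔_; Inverse)
open import Relation.Binary.PropositionalEquality using (_≡_)
open import Relation.Unary using (Pred)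

data Z2u : Set where
  𝟘 𝟙 𝕦 𝟙+𝕦 : Z2u

toPair : Z2u → Bool × Bool
toPair 𝟘   = false , false
toPair 𝟙   = true  , false
toPair 𝕦   = false , true
toPair 𝟙+𝕦 = true  , true

fromPair : Bool × Bool → Z2u
fromPair (false , false) = 𝟘
fromPair (true  , false) = 𝟙
fromPair (false , true)  = 𝕦
fromPair (true  , true)  = 𝟙+𝕦

_+u_ : Z2u → Z2u → Z2u
x +u y with toPair x | toPair y
... | (a , b) | (c , d) = fromPair (a xor c , b xor d)

-- (a + b u)(c + d u) = ac + (ad + bc) u
_*u_ : Z2u → Z2u → Z2u
x *u y with toPair x | toPair y
... | (a , b) | (c , d) = fromPair (a ∧ c , (a ∧ d) xor (b ∧ c))

π : Z2u → Bool
π 𝟘   = false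
π 𝟙   = true
π 𝕦   = false
π 𝟙+𝕦 = true

ψ : Z2u → Vec Bool 2
ψ 𝟘   = false ∷ false ∷ []
ψ 𝟙   = false ∷ true  ∷ []
ψ 𝕦   = true  ∷ true  ∷ []
ψ 𝟙+𝕦 = true  ∷ false ∷ []

Ambient : ℕ → ℕ → Set
Ambient α β = Vec Bool α × Vec Z2u β

zeroA : ∀ {α β} → Ambient α β
zeroA = replicate _ false , replicate _ 𝟘

_⊕_ : ∀ {α β} → Ambient α β → Ambient α β → Ambient α β
(x , x') ⊕ (y , y') = zipWith _xor_ x y , zipWith _+u_ x' y'

_⊙_ : ∀ {α β} → Z2u → Ambient α β → Ambient α β
λ' ⊙ (x , x') = map (π λ' ∧_) x , map (λ' *u_) x'

record IsAdditive {α β : ℕ} (𝒞 : Pred (Ambient α β) 0ℓ) : Set where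
  field
    has-zero  : 𝒞 zeroA
    closed-+  : ∀ {x y} → 𝒞 x → 𝒞 y → 𝒞 (x ⊕ y)
    closed-·  : ∀ (λ' : Z2u) {x} → 𝒞 x → 𝒞 (λ' ⊙ x)

Ψ : ∀ {α β} → Ambient α β → Vec Bool (α + β * 2)
Ψ (x , x') = x ++ concat (map ψ x')

BinCode : ℕ → Set₁
BinCode n = Pred (Vec Bool n) 0ℓ

-- C is Z2Z2[u]-linear with parameters (α, β): there is a bijection
-- σ : Fin (α + 2β) ↔ Fin n (a coordinate permutation; its existence forces
-- n = α + 2β) and an additive code 𝒞 with  C^σ = Ψ(𝒞), where
-- C^σ = { (c_{σ(i)})_i : c ∈ C }.
IsZ2Z2uLinear : ∀ {n} → BinCode n → ℕ → ℕ → Set₁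
IsZ2Z2uLinear {n} C α β =
  Σ (Fin (α + β * 2) ↔ Fin n) λ σ →
  Σ (Pred (Ambient α β) 0ℓ) λ 𝒞 →
    IsAdditive 𝒞 ×
    (∀ (c : Vec Bool n) →
       C c ⇔ (∃ λ y → 𝒞 y × Ψ y ≡ tabulate (λ i → lookup c (Inverse.to σ i))))

-- Golay codes.
-- G23 : the cyclic code of length 23 with generator polynomial
--   g(x) = 1 + x^2 + x^4 + x^5 + x^6 + x^10 + x^11,
-- spanned by x^i g(x), i = 0..11.  (Binary [23,12,7] Golay code.)

gcoef : ℕ → Bool
gcoef 0  = true
gcoef 1  = false
gcoef 2  = true
gcoef 3  = false
gcoef 4  = true
gcoef 5  = true
gcoef 6  = true
gcoef 7  = false
gcoef 8  = false
gcoef 9  = false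
gcoef 10 = true
gcoef 11 = true
gcoef _  = false

golayRow : Fin 12 → Vec Bool 23
golayRow i = tabulate λ j →
  if toℕ i ≤ᵇ toℕ j then gcoef (toℕ j ∸ toℕ i) else false

golayEncode : Vec Bool 12 → Vec Bool 23
golayEncode m =
  foldr′ (zipWith _xor_) (replicate 23 false)
         (zipWith (λ b r → map (b ∧_) r) m (tabulate golayRow))

G23 : BinCode 23
G23 c = ∃ λ (m : Vec Bool 12) → golayEncode m ≡ c

parity : ∀ {n} → Vec Bool n → Bool
parity = foldr′ _xor_ false

G24 : BinCode 24
G24 c = ∃ λ (d : Vec Bool 23) → G23 d × (d ++ (parity d ∷ [])) ≡ c

-- Order the coordinates of C by σ so that the ℤ₂[u]-coordinates come in consecutive pairs.
-- The Gray map turns multiplication by 1 + u into the swap of the two bits of every pair, and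
-- u = 1 + (1 + u), so C is ℤ₂ℤ₂[u]-linear for σ exactly when it is a linear code invariant under
-- the swap conjugated by σ.  The three structures are exhibited this way, the invariance being
-- checked on a generator matrix.
--
-- Conversely, let D be the reordered G₂₄ (for G₂₃ append the parity bit as one more
-- ℤ₂-coordinate, so that α + 1 takes the place of α).  D is self-dual with weights in
-- {0, 8, 12, 16, 24} and swap-invariant.  For v = x ++ w ∈ D the product v · swap v is the
-- parity of x and vanishes, so 1ᵅ0²ᵝ ∈ D⊥ = D and α is one of these weights.  Moreover
-- v ⊻ swap v ∈ D is 0ᵅ followed by the doubled pair sums of w, so every pair sum a ∈ ℤ₂ᵝ has
-- 2 wt a ∈ {0, 8, 12, 16, 24}, while every b ∈ ℤ₂ᵝ violating this pairs nontrivially with some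
-- pair sum.  For (α, β) = (16, 4) and (12, 6) a small search shows these requirements
-- incompatible, and α = 24 leaves β = 0.

module Submission where

open import Defs
open import Data.Nat using (ℕ; _<_)
open import Data.Product using (_×_)
open import Data.Sum using (_⊎_)
open import Relation.Binary.PropositionalEquality using (_≡_)

open import Level using (0ℓ)
open import Algebra.Bundles using (CommutativeMonoid; CommutativeRing)
import Algebra.Properties.CommutativeMonoid.Sum as MonoidSum
import Algebra.Properties.CommutativeSemigroup as CommutativeSemigroupProperties
open import Data.Bool using (Bool; true; false; _∧_; _xor_; not; if_then_else_)
import Data.Bool.Properties as Boolₚ
open import Data.Nat using (zero; suc; _+_; _*_; _≤ᵇ_; _∸_)
import Data.Nat.Properties as ℕₚ
open import Data.Fin as Fin using (Fin; toℕ; #_)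
import Data.Fin.Properties as Finₚ
open import Data.Fin.Permutation using (↔⇒≡)
open import Data.Vec as Vec
  using (Vec; []; _∷_; tabulate; lookup; zipWith; replicate; foldr′; map; _++_; concat; take; drop)
import Data.Vec.Properties as Vecₚ
open import Data.List as List using (List)
open import Data.List.Membership.Propositional using (_∈_)
open import Data.List.Membership.DecPropositional ℕₚ._≟_ using (_∈?_)
open import Data.List.Relation.Unary.Any using (here; there)
open import Data.Product using (∃; ∃₂; _,_; proj₁; proj₂)
open import Data.Sum using (inj₁; inj₂)
open import Data.Empty using (⊥; ⊥-elim)
open import Function using (_∘_; id; _↔_; _⇔_; Inverse; Equivalence; mk⇔; mk↔ₛ′)
open import Function.Properties.Inverse using (↔-sym)
open import Relation.Binary.PropositionalEquality
  using (refl; sym; trans; cong; cong₂; subst; module ≡-Reasoning)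
open import Relation.Nullary using (Dec; does; ¬_; map′; _×-dec_; _→-dec_; ¬?)
open import Relation.Nullary.Decidable using (True; toWitness; from-yes; from-no)
open import Relation.Nullary.Negation using (contradiction)
open import Relation.Unary using (Pred; Decidable)

private
  variable
    k m n α β : ℕ
    A : Set

all-vec? : {P : Vec Bool n → Set} → Decidable P → Dec (∀ v → P v)
all-vec? {zero}  P? = map′ (λ p → λ { [] → p }) (λ h → h []) (P? [])
all-vec? {suc n} P? =
  map′ (λ (f , t) → λ { (false ∷ v) → f v ; (true ∷ v) → t v })
       (λ h → (λ v → h (false ∷ v)) , (λ v → h (true ∷ v)))
       (all-vec? (P? ∘ (false ∷_)) ×-dec all-vec? (P? ∘ (true ∷_)))

module Total (M : CommutativeMonoid 0ℓ 0ℓ) where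
  open CommutativeMonoid M renaming (refl to ≈-refl; sym to ≈-sym; trans to ≈-trans)
  open MonoidSum M using (sum; sum-permute)
  open import Relation.Binary.Reasoning.Setoid setoid

  total : Vec Carrier n → Carrier
  total = foldr′ _∙_ ε

  total-++ : (u : Vec Carrier m) (v : Vec Carrier n) → total (u ++ v) ≈ total u ∙ total v
  total-++ []      v = ≈-sym (identityˡ (total v))
  total-++ (x ∷ u) v = begin
    x ∙ total (u ++ v)       ≈⟨ ∙-congˡ (total-++ u v) ⟩
    x ∙ (total u ∙ total v)  ≈⟨ assoc x (total u) (total v) ⟨
    (x ∙ total u) ∙ total v  ∎

  total-zipWith : (u v : Vec Carrier n) → total (zipWith _∙_ u v) ≈ total u ∙ total v
  total-zipWith []      []      = ≈-sym (identityˡ ε)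
  total-zipWith (x ∷ u) (y ∷ v) = begin
    (x ∙ y) ∙ total (zipWith _∙_ u v)  ≈⟨ ∙-congˡ (total-zipWith u v) ⟩
    (x ∙ y) ∙ (total u ∙ total v)      ≈⟨ interchange x y (total u) (total v) ⟩
    (x ∙ total u) ∙ (y ∙ total v)      ∎
    where open CommutativeSemigroupProperties commutativeSemigroup using (interchange)

  total-replicate-ε : ∀ {n} → total (replicate n ε) ≈ ε
  total-replicate-ε {zero}  = ≈-refl
  total-replicate-ε {suc n} = ≈-trans (identityˡ _) (total-replicate-ε {n})

  total≈sum : (v : Vec Carrier n) → total v ≈ sum (lookup v)
  total≈sum []      = ≈-refl
  total≈sum (x ∷ v) = ∙-congˡ (total≈sum v)

  total-permute : ∀ {m n} (σ : Fin m ↔ Fin n) (v : Vec Carrier n) →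
                  total (tabulate (λ i → lookup v (Inverse.to σ i))) ≈ total v
  total-permute {m} {n} σ v = begin
    total (tabulate (lookup v ∘ Inverse.to σ))          ≈⟨ total≈sum (tabulate (lookup v ∘ Inverse.to σ)) ⟩
    sum (lookup (tabulate (lookup v ∘ Inverse.to σ)))   ≡⟨ MonoidSum.sum-cong-≗ M {m} (Vecₚ.lookup∘tabulate _) ⟩
    sum (lookup v ∘ Inverse.to σ)                       ≈⟨ sum-permute {m} {n} (lookup v) σ ⟨
    sum (lookup v)                                      ≈⟨ total≈sum v ⟨
    total v                                             ∎

infixl 6 _⊻_
_⊻_ : Vec Bool n → Vec Bool n → Vec Bool n
_⊻_ = zipWith _xor_

𝟎 : Vec Bool n
𝟎 = replicate _ false

⊻-assoc : (u v w : Vec Bool n) → (u ⊻ v) ⊻ w ≡ u ⊻ (v ⊻ w)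
⊻-assoc = Vecₚ.zipWith-assoc Boolₚ.xor-assoc

⊻-identityˡ : (u : Vec Bool n) → 𝟎 ⊻ u ≡ u
⊻-identityˡ = Vecₚ.zipWith-identityˡ Boolₚ.xor-identityˡ

⊻-identityʳ : (u : Vec Bool n) → u ⊻ 𝟎 ≡ u
⊻-identityʳ = Vecₚ.zipWith-identityʳ Boolₚ.xor-identityʳ

⊻-self : (u : Vec Bool n) → u ⊻ u ≡ 𝟎
⊻-self []      = refl
⊻-self (x ∷ u) = cong₂ _∷_ (Boolₚ.xor-same x) (⊻-self u)

⊻-interchange : (u v w z : Vec Bool n) → (u ⊻ v) ⊻ (w ⊻ z) ≡ (u ⊻ w) ⊻ (v ⊻ z)
⊻-interchange []      []      []      []      = refl
⊻-interchange (a ∷ u) (b ∷ v) (c ∷ w) (d ∷ z) =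
  cong₂ _∷_ (interchange a b c d) (⊻-interchange u v w z)
  where open CommutativeSemigroupProperties
               (CommutativeRing.+-commutativeSemigroup Boolₚ.xor-∧-commutativeRing)

⊻≡𝟎⇒≡ : (u v : Vec Bool n) → u ⊻ v ≡ 𝟎 → u ≡ v
⊻≡𝟎⇒≡ u v u⊻v≡𝟎 = begin
  u              ≡⟨ ⊻-identityʳ u ⟨
  u ⊻ 𝟎          ≡⟨ cong (u ⊻_) (⊻-self v) ⟨
  u ⊻ (v ⊻ v)    ≡⟨ ⊻-assoc u v v ⟨
  (u ⊻ v) ⊻ v    ≡⟨ cong (_⊻ v) u⊻v≡𝟎 ⟩
  𝟎 ⊻ v          ≡⟨ ⊻-identityˡ v ⟩
  v              ∎
  where open ≡-Reasoning

++-⊻ : (u : Vec Bool m) (v : Vec Bool n) (w : Vec Bool m) (z : Vec Bool n) →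
       (u ++ v) ⊻ (w ++ z) ≡ (u ⊻ w) ++ (v ⊻ z)
++-⊻ = Vecₚ.zipWith-++ _xor_

𝟎++𝟎 : 𝟎 {m} ++ 𝟎 {n} ≡ 𝟎
𝟎++𝟎 {zero}  = refl
𝟎++𝟎 {suc m} = cong (false ∷_) (𝟎++𝟎 {m})

lookup-ext : {u v : Vec A n} → (∀ i → lookup u i ≡ lookup v i) → u ≡ v
lookup-ext {u = u} {v} eq =
  trans (sym (Vecₚ.tabulate∘lookup u)) (trans (Vecₚ.tabulate-cong eq) (Vecₚ.tabulate∘lookup v))

module Parity = Total (CommutativeRing.+-commutativeMonoid Boolₚ.xor-∧-commutativeRing)

module Count = Total ℕₚ.+-0-commutativeMonoid

parity-⊻ : (u v : Vec Bool n) → parity (u ⊻ v) ≡ parity u xor parity v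
parity-⊻ = Parity.total-zipWith

parity-++ : (u : Vec Bool m) (v : Vec Bool n) → parity (u ++ v) ≡ parity u xor parity v
parity-++ = Parity.total-++

parity-𝟎 : parity (𝟎 {n}) ≡ false
parity-𝟎 {n} = Parity.total-replicate-ε {n}

dot : Vec Bool n → Vec Bool n → Bool
dot u v = parity (zipWith _∧_ u v)

dot-comm : (u v : Vec Bool n) → dot u v ≡ dot v u
dot-comm u v = cong parity (Vecₚ.zipWith-comm Boolₚ.∧-comm u v)

dot-⊻ˡ : (u v w : Vec Bool n) → dot (u ⊻ v) w ≡ dot u w xor dot v w
dot-⊻ˡ u v w = trans (cong parity (Vecₚ.zipWith-distribʳ Boolₚ.∧-distribʳ-xor w u v))
                     (parity-⊻ (zipWith _∧_ u w) (zipWith _∧_ v w))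

dot-𝟎ˡ : (u : Vec Bool n) → dot 𝟎 u ≡ false
dot-𝟎ˡ {n} u = trans (cong parity (Vecₚ.zipWith-zeroˡ Boolₚ.∧-zeroˡ u)) (parity-𝟎 {n})

dot-++ : (u : Vec Bool m) (v : Vec Bool n) (w : Vec Bool m) (z : Vec Bool n) →
         dot (u ++ v) (w ++ z) ≡ dot u w xor dot v z
dot-++ u v w z =
  trans (cong parity (Vecₚ.zipWith-++ _∧_ u v w z)) (parity-++ (zipWith _∧_ u w) (zipWith _∧_ v z))

dot-self : (u : Vec Bool n) → dot u u ≡ parity u
dot-self u = cong parity (Vecₚ.zipWith-idem Boolₚ.∧-idem u)

dot-ones : (u : Vec Bool n) → dot (replicate n true) u ≡ parity u
dot-ones u = cong parity (Vecₚ.zipWith-identityˡ Boolₚ.∧-identityˡ u)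

bit : Bool → ℕ
bit b = if b then 1 else 0

wt : Vec Bool n → ℕ
wt v = Count.total (map bit v)

wt-++ : (u : Vec Bool m) (v : Vec Bool n) → wt (u ++ v) ≡ wt u + wt v
wt-++ u v = trans (cong Count.total (Vecₚ.map-++ bit u v)) (Count.total-++ (map bit u) (map bit v))

wt-𝟎 : wt (𝟎 {n}) ≡ 0
wt-𝟎 {n} = trans (cong Count.total (Vecₚ.map-replicate bit false n)) (Count.total-replicate-ε {n})

wt-𝟎++ : (v : Vec Bool n) → wt (𝟎 {m} ++ v) ≡ wt v
wt-𝟎++ {m = m} v = trans (wt-++ (𝟎 {m}) v) (cong (_+ wt v) (wt-𝟎 {m}))

wt-ones : wt (replicate n true) ≡ n
wt-ones {zero}  = refl
wt-ones {suc n} = cong suc (wt-ones {n})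

reindex : (Fin m → Fin n) → Vec A n → Vec A m
reindex f c = tabulate (λ i → lookup c (f i))

lookup-reindex : (f : Fin m → Fin n) (c : Vec A n) (i : Fin m) → lookup (reindex f c) i ≡ lookup c (f i)
lookup-reindex f c = Vecₚ.lookup∘tabulate (lookup c ∘ f)

reindex-zipWith : {B C : Set} (f : Fin m → Fin n) (g : A → B → C) (u : Vec A n) (v : Vec B n) →
                  reindex f (zipWith g u v) ≡ zipWith g (reindex f u) (reindex f v)
reindex-zipWith f g u v = lookup-ext λ i → begin
  lookup (reindex f (zipWith g u v)) i               ≡⟨ lookup-reindex f (zipWith g u v) i ⟩
  lookup (zipWith g u v) (f i)                       ≡⟨ Vecₚ.lookup-zipWith g (f i) u v ⟩
  g (lookup u (f i)) (lookup v (f i))                ≡⟨ cong₂ g (lookup-reindex f u i) (lookup-reindex f v i) ⟨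
  g (lookup (reindex f u) i) (lookup (reindex f v) i) ≡⟨ Vecₚ.lookup-zipWith g i (reindex f u) (reindex f v) ⟨
  lookup (zipWith g (reindex f u) (reindex f v)) i   ∎
  where open ≡-Reasoning

reindex-map : {B : Set} (f : Fin m → Fin n) (g : A → B) (c : Vec A n) →
              reindex f (map g c) ≡ map g (reindex f c)
reindex-map f g c = lookup-ext λ i → begin
  lookup (reindex f (map g c)) i  ≡⟨ lookup-reindex f (map g c) i ⟩
  lookup (map g c) (f i)          ≡⟨ Vecₚ.lookup-map (f i) g c ⟩
  g (lookup c (f i))              ≡⟨ cong g (lookup-reindex f c i) ⟨
  g (lookup (reindex f c) i)      ≡⟨ Vecₚ.lookup-map i g (reindex f c) ⟨
  lookup (map g (reindex f c)) i  ∎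
  where open ≡-Reasoning

reindex-replicate : (f : Fin m → Fin n) (x : A) → reindex f (replicate n x) ≡ replicate m x
reindex-replicate {n = n} f x = lookup-ext λ i →
  trans (lookup-reindex f (replicate n x) i)
        (trans (Vecₚ.lookup-replicate (f i) x) (sym (Vecₚ.lookup-replicate i x)))

permute : Fin m ↔ Fin n → Vec A n → Vec A m
permute σ = reindex (Inverse.to σ)

unpermute : Fin m ↔ Fin n → Vec A m → Vec A n
unpermute σ = permute (↔-sym σ)

permute-unpermute : (σ : Fin m ↔ Fin n) (v : Vec A m) → permute σ (unpermute σ v) ≡ v
permute-unpermute σ v = lookup-ext λ i →
  trans (lookup-reindex (Inverse.to σ) (unpermute σ v) i)
        (trans (lookup-reindex (Inverse.from σ) v (Inverse.to σ i))
               (cong (lookup v) (Inverse.strictlyInverseʳ σ i)))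

unpermute-permute : (σ : Fin m ↔ Fin n) (c : Vec A n) → unpermute σ (permute σ c) ≡ c
unpermute-permute σ = permute-unpermute (↔-sym σ)

module _ (σ : Fin m ↔ Fin n) where

  permute-⊻ : (u v : Vec Bool n) → permute σ (u ⊻ v) ≡ permute σ u ⊻ permute σ v
  permute-⊻ = reindex-zipWith (Inverse.to σ) _xor_

  parity-permute : (c : Vec Bool n) → parity (permute σ c) ≡ parity c
  parity-permute = Parity.total-permute σ

  dot-permute : (u v : Vec Bool n) → dot (permute σ u) (permute σ v) ≡ dot u v
  dot-permute u v = trans (cong parity (sym (reindex-zipWith (Inverse.to σ) _∧_ u v)))
                          (parity-permute (zipWith _∧_ u v))

  wt-permute : (c : Vec Bool n) → wt (permute σ c) ≡ wt c
  wt-permute c = trans (cong Count.total (sym (reindex-map (Inverse.to σ) bit c)))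
                       (Count.total-permute σ (map bit c))

Additive : (Vec Bool m → Vec Bool n) → Set
Additive f = ∀ u v → f (u ⊻ v) ≡ f u ⊻ f v

additive-𝟎 : {f : Vec Bool m → Vec Bool n} → Additive f → f 𝟎 ≡ 𝟎
additive-𝟎 {f = f} f-⊻ = trans (cong f (sym (⊻-self 𝟎))) (trans (f-⊻ 𝟎 𝟎) (⊻-self (f 𝟎)))

infixr 7 _·_
_·_ : Bool → Vec Bool n → Vec Bool n
b · r = map (b ∧_) r

·-distribʳ-xor : (a b : Bool) (r : Vec Bool n) → (a xor b) · r ≡ a · r ⊻ b · r
·-distribʳ-xor a b []      = refl
·-distribʳ-xor a b (x ∷ r) = cong₂ _∷_ (Boolₚ.∧-distribʳ-xor x a b) (·-distribʳ-xor a b r)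

additive-· : {f : Vec Bool m → Vec Bool n} → Additive f → ∀ b r → f (b · r) ≡ b · f r
additive-· {f = f} f-⊻ true  r = trans (cong f (Vecₚ.map-id r)) (sym (Vecₚ.map-id (f r)))
additive-· {f = f} f-⊻ false r =
  trans (cong f (Vecₚ.map-const r false)) (trans (additive-𝟎 f-⊻) (sym (Vecₚ.map-const (f r) false)))

encode : Vec (Vec Bool n) k → Vec Bool k → Vec Bool n
encode R m = foldr′ _⊻_ 𝟎 (zipWith _·_ m R)

encode-⊻ : (R : Vec (Vec Bool n) k) → Additive (encode R)
encode-⊻ []      []      []        = sym (⊻-self 𝟎)
encode-⊻ (r ∷ R) (b ∷ m) (b′ ∷ m′) = begin
  (b xor b′) · r ⊻ encode R (m ⊻ m′)
    ≡⟨ cong₂ _⊻_ (·-distribʳ-xor b b′ r) (encode-⊻ R m m′) ⟩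
  (b · r ⊻ b′ · r) ⊻ (encode R m ⊻ encode R m′)
    ≡⟨ ⊻-interchange (b · r) (b′ · r) (encode R m) (encode R m′) ⟩
  (b · r ⊻ encode R m) ⊻ (b′ · r ⊻ encode R m′)
    ∎
  where open ≡-Reasoning

encode-additive : {f : Vec Bool m → Vec Bool n} → Additive f →
                  (R : Vec (Vec Bool m) k) (c : Vec Bool k) → f (encode R c) ≡ encode (map f R) c
encode-additive f-⊻ []      []      = additive-𝟎 f-⊻
encode-additive f-⊻ (r ∷ R) (b ∷ c) =
  trans (f-⊻ (b · r) (encode R c)) (cong₂ _⊻_ (additive-· f-⊻ b r) (encode-additive f-⊻ R c))

record IsLinearCode (C : Vec Bool n → Set) : Set where
  field
    𝟎∈      : C 𝟎
    ⊻-closed : ∀ {u v} → C u → C v → C (u ⊻ v)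

  ·-closed : ∀ b {u} → C u → C (b · u)
  ·-closed true  {u} = subst C (sym (Vecₚ.map-id u))
  ·-closed false {u} _ = subst C (sym (Vecₚ.map-const u false)) 𝟎∈

  encode-closed : (R : Vec (Vec Bool n) k) → (∀ i → C (lookup R i)) → ∀ m → C (encode R m)
  encode-closed []      R⊆C []      = 𝟎∈
  encode-closed (r ∷ R) R⊆C (b ∷ m) =
    ⊻-closed (·-closed b (R⊆C Fin.zero)) (encode-closed R (R⊆C ∘ Fin.suc) m)

  additive-closed : {f : Vec Bool m → Vec Bool n} → Additive f → (R : Vec (Vec Bool m) k) →
                    (∀ i → C (f (lookup R i))) → ∀ c → C (f (encode R c))
  additive-closed {f = f} f-⊻ R fR⊆C c =
    subst C (sym (encode-additive f-⊻ R c))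
          (encode-closed (map f R) (λ i → subst C (sym (Vecₚ.lookup-map i f R)) (fR⊆C i)) c)

Span : Vec (Vec Bool n) k → Vec Bool n → Set
Span R c = ∃ λ m → encode R m ≡ c

span-linear : (R : Vec (Vec Bool n) k) → IsLinearCode (Span R)
span-linear R = record
  { 𝟎∈      = 𝟎 , additive-𝟎 (encode-⊻ R)
  ; ⊻-closed = λ { (m , refl) (m′ , refl) → m ⊻ m′ , encode-⊻ R m m′ }
  }

orthogonal-linear : (w : Vec Bool n) → IsLinearCode (λ u → dot u w ≡ false)
orthogonal-linear w = record
  { 𝟎∈      = dot-𝟎ˡ w
  ; ⊻-closed = λ {u} {v} u⊥w v⊥w → trans (dot-⊻ˡ u v w) (cong₂ _xor_ u⊥w v⊥w)
  }

RowsOrthogonal : Vec (Vec Bool n) k → Set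
RowsOrthogonal R = ∀ i j → dot (lookup R i) (lookup R j) ≡ false

rowsOrthogonal? : (R : Vec (Vec Bool n) k) → Dec (RowsOrthogonal R)
rowsOrthogonal? R = Finₚ.all? λ i → Finₚ.all? λ j → dot (lookup R i) (lookup R j) Boolₚ.≟ false

module _ {R : Vec (Vec Bool n) k} (R⊥R : RowsOrthogonal R) where

  span⊥rows : ∀ {u} → Span R u → ∀ i → dot u (lookup R i) ≡ false
  span⊥rows (m , refl) i = encode-closed R (λ j → R⊥R j i) m
    where open IsLinearCode (orthogonal-linear (lookup R i))

  span-self-orthogonal : ∀ {u v} → Span R u → Span R v → dot u v ≡ false
  span-self-orthogonal {u} u∈ (m , refl) =
    trans (dot-comm u (encode R m)) (encode-closed R (λ i → trans (dot-comm _ u) (span⊥rows u∈ i)) m)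
    where open IsLinearCode (orthogonal-linear u)

HeadInverse : Vec (Vec Bool (k + n)) k → (Vec Bool k → Vec Bool k) → Set
HeadInverse {k} R decode = ∀ w → take k (encode R (decode w)) ≡ w

headInverse? : (R : Vec (Vec Bool (k + n)) k) (decode : Vec Bool k → Vec Bool k) →
               Dec (HeadInverse R decode)
headInverse? {k} R decode = all-vec? λ w → Vecₚ.≡-dec Boolₚ._≟_ (take k (encode R (decode w))) w

TailDualTrivial : Vec (Vec Bool (k + n)) k → Set
TailDualTrivial {k} R = ∀ z → (∀ i → dot (𝟎 {k} ++ z) (lookup R i) ≡ false) → z ≡ 𝟎

tailDualTrivial? : (R : Vec (Vec Bool (k + n)) k) → Dec (TailDualTrivial R)
tailDualTrivial? {k} R = all-vec? λ z →
  (Finₚ.all? λ i → dot (𝟎 {k} ++ z) (lookup R i) Boolₚ.≟ false) →-dec Vecₚ.≡-dec Boolₚ._≟_ z 𝟎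

-- The coefficients of x are read off its first k coordinates; removing their combination
-- leaves a vector orthogonal to R with vanishing head.
span-complete : {R : Vec (Vec Bool (k + n)) k} {decode : Vec Bool k → Vec Bool k} →
                RowsOrthogonal R → HeadInverse R decode → TailDualTrivial R →
                ∀ x → (∀ i → dot x (lookup R i) ≡ false) → Span R x
span-complete {k} {R = R} {decode} R⊥R head-inverse tail-trivial x x⊥R =
  decode (take k x) , sym (⊻≡𝟎⇒≡ x c y≡𝟎)
  where
  c = encode R (decode (take k x))
  y = x ⊻ c

  y⊥R : ∀ i → dot y (lookup R i) ≡ false
  y⊥R i = IsLinearCode.⊻-closed (orthogonal-linear (lookup R i)) {x} {c}
            (x⊥R i) (span⊥rows {R = R} R⊥R (decode (take k x) , refl) i)

  y-split : y ≡ 𝟎 {k} ++ drop k y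
  y-split = begin
    y                               ≡⟨ Vecₚ.take++drop≡id k y ⟨
    take k y ++ drop k y            ≡⟨ cong (_++ drop k y) (Vecₚ.take-zipWith _xor_ x c) ⟩
    (take k x ⊻ take k c) ++ drop k y ≡⟨ cong (λ h → (take k x ⊻ h) ++ drop k y) (head-inverse (take k x)) ⟩
    (take k x ⊻ take k x) ++ drop k y ≡⟨ cong (_++ drop k y) (⊻-self (take k x)) ⟩
    𝟎 ++ drop k y                   ∎
    where open ≡-Reasoning

  y≡𝟎 : y ≡ 𝟎
  y≡𝟎 = trans y-split (trans (cong (𝟎 {k} ++_) (tail-trivial (drop k y) tail⊥R)) (𝟎++𝟎 {k}))
    where
    tail⊥R : ∀ i → dot (𝟎 {k} ++ drop k y) (lookup R i) ≡ false
    tail⊥R i = subst (λ v → dot v (lookup R i) ≡ false) y-split (y⊥R i)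

golay23Rows : Vec (Vec Bool 23) 12
golay23Rows = tabulate golayRow

golay23-linear : IsLinearCode G23
golay23-linear = span-linear golay23Rows

extend : Vec Bool n → Vec Bool (n + 1)
extend d = d ++ (parity d ∷ [])

extend-⊻ : Additive (extend {n})
extend-⊻ u v = trans (cong (λ p → (u ⊻ v) ++ (p ∷ [])) (parity-⊻ u v))
                     (sym (++-⊻ u (parity u ∷ []) v (parity v ∷ [])))

golay24Rows : Vec (Vec Bool 24) 12
golay24Rows = map extend golay23Rows

golay24⇒span : ∀ {c} → G24 c → Span golay24Rows c
golay24⇒span (_ , (m , refl) , refl) = m , sym (encode-additive extend-⊻ golay23Rows m)

span⇒golay24 : ∀ {c} → Span golay24Rows c → G24 c
span⇒golay24 (m , refl) = encode golay23Rows m , (m , refl) , encode-additive extend-⊻ golay23Rows m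

golay24-linear : IsLinearCode G24
golay24-linear = record
  { 𝟎∈      = span⇒golay24 𝟎∈
  ; ⊻-closed = λ u∈ v∈ → span⇒golay24 (⊻-closed (golay24⇒span u∈) (golay24⇒span v∈))
  }
  where open IsLinearCode (span-linear golay24Rows)

golayWeights : List ℕ
golayWeights = 0 List.∷ 8 List.∷ 12 List.∷ 16 List.∷ 24 List.∷ List.[]

WeightsIn : List ℕ → Vec (Vec Bool n) k → Set
WeightsIn W R = ∀ m → wt (encode R m) ∈ W

weightsIn? : (W : List ℕ) (R : Vec (Vec Bool n) k) → Dec (WeightsIn W R)
weightsIn? W R = all-vec? λ m → wt (encode R m) ∈? W

-- The leading 12 × 12 block of the generator matrix is the unitriangular Toeplitz matrix
-- of g; its inverse is the Toeplitz matrix of g⁻¹ mod x¹² = 1 + x² + x⁵ + x⁸ + x⁹ + x¹⁰ + x¹¹.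
golayDecode : Vec Bool 12 → Vec Bool 12
golayDecode w = tabulate λ i →
  dot (tabulate λ j → if toℕ j ≤ᵇ toℕ i then ginv (toℕ i ∸ toℕ j) else false) w
  where
  ginv : ℕ → Bool
  ginv e = does (e ∈? (0 List.∷ 2 List.∷ 5 List.∷ 8 List.∷ 9 List.∷ 10 List.∷ 11 List.∷ List.[]))

golay24-rows-orthogonal : RowsOrthogonal golay24Rows
golay24-rows-orthogonal = from-yes (rowsOrthogonal? golay24Rows)

golay24-head-inverse : HeadInverse golay24Rows golayDecode
golay24-head-inverse = from-yes (headInverse? golay24Rows golayDecode)

golay24-tail-dual-trivial : TailDualTrivial golay24Rows
golay24-tail-dual-trivial = from-yes (tailDualTrivial? golay24Rows)

golay24-weights : WeightsIn golayWeights golay24Rows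
golay24-weights = from-yes (weightsIn? golayWeights golay24Rows)

golay24-complete : ∀ x → (∀ i → dot x (lookup golay24Rows i) ≡ false) → G24 x
golay24-complete x x⊥rows = span⇒golay24
  (span-complete {decode = golayDecode} golay24-rows-orthogonal golay24-head-inverse golay24-tail-dual-trivial x x⊥rows)

golay24-row : ∀ i → G24 (lookup golay24Rows i)
golay24-row i = golay24-complete _ (golay24-rows-orthogonal i)

golay24-self-orthogonal : ∀ {u v} → G24 u → G24 v → dot u v ≡ false
golay24-self-orthogonal u∈ v∈ =
  span-self-orthogonal golay24-rows-orthogonal (golay24⇒span u∈) (golay24⇒span v∈)

golay24-weight : ∀ {c} → G24 c → wt c ∈ golayWeights
golay24-weight c∈ with golay24⇒span c∈
... | m , refl = golay24-weights m

golay24-split : ∀ {c : Vec Bool 23} {b} → G24 (c ++ (b ∷ [])) → G23 c × parity c ≡ b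
golay24-split {c} (d , d∈ , extend-d≡) with Vecₚ.++-injective d c extend-d≡
... | refl , parity≡ = d∈ , Vecₚ.∷-injectiveˡ parity≡

swapPairs : ∀ β → Vec Bool (β * 2) → Vec Bool (β * 2)
swapPairs zero    []          = []
swapPairs (suc β) (a ∷ b ∷ w) = b ∷ a ∷ swapPairs β w

swap : ∀ α β → Vec Bool (α + β * 2) → Vec Bool (α + β * 2)
swap zero    β w       = swapPairs β w
swap (suc α) β (x ∷ v) = x ∷ swap α β v

swap-++ : (x : Vec Bool α) (w : Vec Bool (β * 2)) → swap α β (x ++ w) ≡ x ++ swapPairs β w
swap-++ []      w = refl
swap-++ (a ∷ x) w = cong (a ∷_) (swap-++ x w)

swapPairs-⊻ : ∀ β → Additive (swapPairs β)
swapPairs-⊻ zero    []          []            = refl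
swapPairs-⊻ (suc β) (a ∷ b ∷ w) (a′ ∷ b′ ∷ w′) =
  cong (λ t → (b xor b′) ∷ (a xor a′) ∷ t) (swapPairs-⊻ β w w′)

swap-⊻ : ∀ α β → Additive (swap α β)
swap-⊻ zero    β w       w′        = swapPairs-⊻ β w w′
swap-⊻ (suc α) β (x ∷ v) (x′ ∷ v′) = cong ((x xor x′) ∷_) (swap-⊻ α β v v′)

parity-swap : ∀ α β (v : Vec Bool (α + β * 2)) → parity (swap α β v) ≡ parity v
parity-swap zero    zero    []          = refl
parity-swap zero    (suc β) (a ∷ b ∷ w) = begin
  b xor (a xor parity (swapPairs β w))   ≡⟨ Boolₚ.xor-assoc b a _ ⟨
  (b xor a) xor parity (swapPairs β w)   ≡⟨ cong₂ _xor_ (Boolₚ.xor-comm b a) (parity-swap zero β w) ⟩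
  (a xor b) xor parity w                 ≡⟨ Boolₚ.xor-assoc a b _ ⟩
  a xor (b xor parity w)                 ∎
  where open ≡-Reasoning
parity-swap (suc α) β (x ∷ v) = cong (x xor_) (parity-swap α β v)

-- On a Gray image Ψ (x , x′) the pair sums are the reduction of x′ mod u.
residue : ∀ β → Vec Bool (β * 2) → Vec Bool β
residue zero    []          = []
residue (suc β) (a ∷ b ∷ w) = (a xor b) ∷ residue β w

double : Vec Bool β → Vec Bool (β * 2)
double []      = []
double (a ∷ v) = a ∷ a ∷ double v

residue-⊻ : (w w′ : Vec Bool (β * 2)) → residue β (w ⊻ w′) ≡ residue β w ⊻ residue β w′
residue-⊻ {zero}  []          []            = refl
residue-⊻ {suc β} (a ∷ b ∷ w) (a′ ∷ b′ ∷ w′) = cong₂ _∷_ (interchange a a′ b b′) (residue-⊻ {β} w w′)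
  where open CommutativeSemigroupProperties
               (CommutativeRing.+-commutativeSemigroup Boolₚ.xor-∧-commutativeRing)

⊻-swapPairs : (w : Vec Bool (β * 2)) → w ⊻ swapPairs β w ≡ double (residue β w)
⊻-swapPairs {zero}  []          = refl
⊻-swapPairs {suc β} (a ∷ b ∷ w) = cong ((a xor b) ∷_) (cong₂ _∷_ (Boolₚ.xor-comm b a) (⊻-swapPairs {β} w))

dot-double : (v : Vec Bool β) (w : Vec Bool (β * 2)) → dot (double v) w ≡ dot v (residue β w)
dot-double []      []          = refl
dot-double (c ∷ v) (a ∷ b ∷ w) = begin
  (c ∧ a) xor ((c ∧ b) xor dot (double v) w)  ≡⟨ Boolₚ.xor-assoc (c ∧ a) (c ∧ b) _ ⟨
  ((c ∧ a) xor (c ∧ b)) xor dot (double v) w  ≡⟨ cong₂ _xor_ (sym (Boolₚ.∧-distribˡ-xor c a b)) (dot-double v w) ⟩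
  (c ∧ (a xor b)) xor dot v (residue _ w)     ∎
  where open ≡-Reasoning

dot-swapPairs : (w : Vec Bool (β * 2)) → dot w (swapPairs β w) ≡ false
dot-swapPairs {zero}  []          = refl
dot-swapPairs {suc β} (a ∷ b ∷ w) = begin
  (a ∧ b) xor ((b ∧ a) xor dot w (swapPairs β w))  ≡⟨ Boolₚ.xor-assoc (a ∧ b) (b ∧ a) _ ⟨
  ((a ∧ b) xor (b ∧ a)) xor dot w (swapPairs β w)  ≡⟨ cong₂ _xor_ ab+ba≡0 (dot-swapPairs {β} w) ⟩
  false                                            ∎
  where
  open ≡-Reasoning
  ab+ba≡0 : (a ∧ b) xor (b ∧ a) ≡ false
  ab+ba≡0 = trans (cong ((a ∧ b) xor_) (Boolₚ.∧-comm b a)) (Boolₚ.xor-same (a ∧ b))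

dot-swap : (x : Vec Bool α) (w : Vec Bool (β * 2)) → dot (x ++ w) (swap α β (x ++ w)) ≡ parity x
dot-swap {β = β} x w = begin
  dot (x ++ w) (swap _ β (x ++ w))            ≡⟨ cong (dot (x ++ w)) (swap-++ x w) ⟩
  dot (x ++ w) (x ++ swapPairs β w)           ≡⟨ dot-++ x w x (swapPairs β w) ⟩
  dot x x xor dot w (swapPairs β w)           ≡⟨ cong₂ _xor_ (dot-self x) (dot-swapPairs {β} w) ⟩
  parity x xor false                          ≡⟨ Boolₚ.xor-identityʳ (parity x) ⟩
  parity x                                    ∎
  where open ≡-Reasoning

⊻-swap : (x : Vec Bool α) (w : Vec Bool (β * 2)) →
         (x ++ w) ⊻ swap α β (x ++ w) ≡ 𝟎 ++ double (residue β w)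
⊻-swap {β = β} x w = begin
  (x ++ w) ⊻ swap _ β (x ++ w)       ≡⟨ cong ((x ++ w) ⊻_) (swap-++ x w) ⟩
  (x ++ w) ⊻ (x ++ swapPairs β w)    ≡⟨ ++-⊻ x w x (swapPairs β w) ⟩
  (x ⊻ x) ++ (w ⊻ swapPairs β w)     ≡⟨ cong₂ _++_ (⊻-self x) (⊻-swapPairs {β} w) ⟩
  𝟎 ++ double (residue β w)          ∎
  where open ≡-Reasoning

gray : Vec Z2u β → Vec Bool (β * 2)
gray = concat ∘ map ψ

ψ-+ : ∀ a b → ψ (a +u b) ≡ ψ a ⊻ ψ b
ψ-+ 𝟘   𝟘   = refl
ψ-+ 𝟘   𝟙   = refl
ψ-+ 𝟘   𝕦   = refl
ψ-+ 𝟘   𝟙+𝕦 = refl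
ψ-+ 𝟙   𝟘   = refl
ψ-+ 𝟙   𝟙   = refl
ψ-+ 𝟙   𝕦   = refl
ψ-+ 𝟙   𝟙+𝕦 = refl
ψ-+ 𝕦   𝟘   = refl
ψ-+ 𝕦   𝟙   = refl
ψ-+ 𝕦   𝕦   = refl
ψ-+ 𝕦   𝟙+𝕦 = refl
ψ-+ 𝟙+𝕦 𝟘   = refl
ψ-+ 𝟙+𝕦 𝟙   = refl
ψ-+ 𝟙+𝕦 𝕦   = refl
ψ-+ 𝟙+𝕦 𝟙+𝕦 = refl

gray-+ : (z z′ : Vec Z2u β) → gray (zipWith _+u_ z z′) ≡ gray z ⊻ gray z′
gray-+ []      []        = refl
gray-+ (a ∷ z) (a′ ∷ z′) =
  trans (cong₂ _++_ (ψ-+ a a′) (gray-+ z z′)) (sym (++-⊻ (ψ a) (gray z) (ψ a′) (gray z′)))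

gray-𝟙+𝕦 : (z : Vec Z2u β) → gray (map (𝟙+𝕦 *u_) z) ≡ swapPairs β (gray z)
gray-𝟙+𝕦 []        = refl
gray-𝟙+𝕦 (𝟘 ∷ z)   = cong (λ w → false ∷ false ∷ w) (gray-𝟙+𝕦 z)
gray-𝟙+𝕦 (𝟙 ∷ z)   = cong (λ w → true ∷ false ∷ w) (gray-𝟙+𝕦 z)
gray-𝟙+𝕦 (𝕦 ∷ z)   = cong (λ w → true ∷ true ∷ w) (gray-𝟙+𝕦 z)
gray-𝟙+𝕦 (𝟙+𝕦 ∷ z) = cong (λ w → false ∷ true ∷ w) (gray-𝟙+𝕦 z)

gray-𝟘 : gray (replicate β 𝟘) ≡ 𝟎
gray-𝟘 {zero}  = refl
gray-𝟘 {suc β} = cong (λ w → false ∷ false ∷ w) (gray-𝟘 {β})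

ungray : ∀ β → Vec Bool (β * 2) → Vec Z2u β
ungray zero    []          = []
ungray (suc β) (a ∷ b ∷ w) = fromψ a b ∷ ungray β w
  where
  fromψ : Bool → Bool → Z2u
  fromψ false false = 𝟘
  fromψ false true  = 𝟙
  fromψ true  true  = 𝕦
  fromψ true  false = 𝟙+𝕦

gray-ungray : (w : Vec Bool (β * 2)) → gray (ungray β w) ≡ w
gray-ungray {zero}  []                  = refl
gray-ungray {suc β} (false ∷ false ∷ w) = cong (λ v → false ∷ false ∷ v) (gray-ungray {β} w)
gray-ungray {suc β} (false ∷ true  ∷ w) = cong (λ v → false ∷ true ∷ v) (gray-ungray {β} w)
gray-ungray {suc β} (true  ∷ false ∷ w) = cong (λ v → true ∷ false ∷ v) (gray-ungray {β} w)
gray-ungray {suc β} (true  ∷ true  ∷ w) = cong (λ v → true ∷ true ∷ v) (gray-ungray {β} w)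

Ψ-⊕ : (y y′ : Ambient α β) → Ψ (y ⊕ y′) ≡ Ψ y ⊻ Ψ y′
Ψ-⊕ {β = β} (x , z) (x′ , z′) =
  trans (cong ((x ⊻ x′) ++_) (gray-+ z z′)) (sym (++-⊻ x (gray {β} z) x′ (gray z′)))

Ψ-𝟙+𝕦 : (y : Ambient α β) → Ψ (𝟙+𝕦 ⊙ y) ≡ swap α β (Ψ y)
Ψ-𝟙+𝕦 {α} {β} (x , z) = trans (cong₂ _++_ (Vecₚ.map-id x) (gray-𝟙+𝕦 z)) (sym (swap-++ {β = β} x (gray z)))

Ψ-zeroA : Ψ (zeroA {α} {β}) ≡ 𝟎
Ψ-zeroA {α} {β} = trans (cong (𝟎 {α} ++_) (gray-𝟘 {β})) (𝟎++𝟎 {α})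

Ψ-surjective : (v : Vec Bool (α + β * 2)) → Ψ (take α v , ungray β (drop α v)) ≡ v
Ψ-surjective {α} {β} v = trans (cong (take α v ++_) (gray-ungray {β} (drop α v))) (Vecₚ.take++drop≡id α v)

⊙-𝟘 : (y : Ambient α β) → 𝟘 ⊙ y ≡ zeroA
⊙-𝟘 (x , z) = cong₂ _,_ (Vecₚ.map-const x false) (trans (Vecₚ.map-cong 𝟘*u z) (Vecₚ.map-const z 𝟘))
  where
  𝟘*u : ∀ a → 𝟘 *u a ≡ 𝟘
  𝟘*u 𝟘   = refl
  𝟘*u 𝟙   = refl
  𝟘*u 𝕦   = refl
  𝟘*u 𝟙+𝕦 = refl

⊙-𝟙 : (y : Ambient α β) → 𝟙 ⊙ y ≡ y
⊙-𝟙 (x , z) = cong₂ _,_ (Vecₚ.map-id x) (trans (Vecₚ.map-cong 𝟙*u z) (Vecₚ.map-id z))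
  where
  𝟙*u : ∀ a → 𝟙 *u a ≡ a
  𝟙*u 𝟘   = refl
  𝟙*u 𝟙   = refl
  𝟙*u 𝕦   = refl
  𝟙*u 𝟙+𝕦 = refl

⊙-𝕦 : (y : Ambient α β) → 𝕦 ⊙ y ≡ y ⊕ (𝟙+𝕦 ⊙ y)
⊙-𝕦 (x , z) = cong₂ _,_ (bits x) (units z)
  where
  bits : (x : Vec Bool k) → map (false ∧_) x ≡ x ⊻ map (true ∧_) x
  bits []      = refl
  bits (b ∷ x) = cong₂ _∷_ (sym (Boolₚ.xor-same b)) (bits x)
  units : (z : Vec Z2u k) → map (𝕦 *u_) z ≡ zipWith _+u_ z (map (𝟙+𝕦 *u_) z)
  units []        = refl
  units (𝟘 ∷ z)   = cong (𝟘 ∷_) (units z)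
  units (𝟙 ∷ z)   = cong (𝕦 ∷_) (units z)
  units (𝕦 ∷ z)   = cong (𝟘 ∷_) (units z)
  units (𝟙+𝕦 ∷ z) = cong (𝕦 ∷_) (units z)

-- ℤ₂ℤ₂[u]-linearity as invariance under the swap

conjugateSwap : ∀ α β → Fin (α + β * 2) ↔ Fin n → Vec Bool n → Vec Bool n
conjugateSwap α β σ c = unpermute σ (swap α β (permute σ c))

swap-closed⇒Z2Z2uLinear : {C : BinCode n} (σ : Fin (α + β * 2) ↔ Fin n) → IsLinearCode C →
                          (∀ {c} → C c → C (conjugateSwap α β σ c)) →
                          IsZ2Z2uLinear C α β
swap-closed⇒Z2Z2uLinear {n} {α} {β} {C} σ C-linear C-swap = σ , 𝒞 , 𝒞-additive , C⇔
  where
  open IsLinearCode C-linear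

  𝒞 : Pred (Ambient α β) 0ℓ
  𝒞 y = C (unpermute σ (Ψ y))

  closed-+ : ∀ {y y′} → 𝒞 y → 𝒞 y′ → 𝒞 (y ⊕ y′)
  closed-+ {y} {y′} y∈ y′∈ = subst C (sym eq) (⊻-closed y∈ y′∈)
    where
    eq : unpermute σ (Ψ (y ⊕ y′)) ≡ unpermute σ (Ψ y) ⊻ unpermute σ (Ψ y′)
    eq = trans (cong (unpermute σ) (Ψ-⊕ y y′)) (permute-⊻ (↔-sym σ) (Ψ y) (Ψ y′))

  closed-𝟙+𝕦 : ∀ {y} → 𝒞 y → 𝒞 (𝟙+𝕦 ⊙ y)
  closed-𝟙+𝕦 {y} y∈ = subst C (cong (unpermute σ) eq) (C-swap y∈)
    where
    eq : swap α β (permute σ (unpermute σ (Ψ y))) ≡ Ψ (𝟙+𝕦 ⊙ y)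
    eq = trans (cong (swap α β) (permute-unpermute σ (Ψ y))) (sym (Ψ-𝟙+𝕦 y))

  has-zero : 𝒞 zeroA
  has-zero = subst C (sym eq) 𝟎∈
    where
    eq : unpermute σ (Ψ (zeroA {α} {β})) ≡ 𝟎
    eq = trans (cong (unpermute σ) (Ψ-zeroA {α} {β})) (reindex-replicate (Inverse.from σ) false)

  closed-· : ∀ λ′ {y} → 𝒞 y → 𝒞 (λ′ ⊙ y)
  closed-· 𝟘   {y} _  = subst 𝒞 (sym (⊙-𝟘 y)) has-zero
  closed-· 𝟙   {y} y∈ = subst 𝒞 (sym (⊙-𝟙 y)) y∈
  closed-· 𝕦   {y} y∈ = subst 𝒞 (sym (⊙-𝕦 y)) (closed-+ {y} {𝟙+𝕦 ⊙ y} y∈ (closed-𝟙+𝕦 {y} y∈))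
  closed-· 𝟙+𝕦 {y} y∈ = closed-𝟙+𝕦 {y} y∈

  𝒞-additive : IsAdditive 𝒞
  𝒞-additive = record
    { has-zero = has-zero ; closed-+ = λ {y} {y′} → closed-+ {y} {y′} ; closed-· = closed-· }

  C⇔ : ∀ c → C c ⇔ (∃ λ y → 𝒞 y × Ψ y ≡ permute σ c)
  C⇔ c = mk⇔ to from
    where
    to : C c → ∃ λ y → 𝒞 y × Ψ y ≡ permute σ c
    to c∈ = y , subst C (sym (trans (cong (unpermute σ) Ψy≡) (unpermute-permute σ c))) c∈ , Ψy≡
      where
      y = take α (permute σ c) , ungray β (drop α (permute σ c))
      Ψy≡ = Ψ-surjective {α} {β} (permute σ c)
    from : (∃ λ y → 𝒞 y × Ψ y ≡ permute σ c) → C c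
    from (y , y∈ , Ψy≡) = subst C (trans (cong (unpermute σ) Ψy≡) (unpermute-permute σ c)) y∈

Z2Z2uLinear⇒swap-closed : {C : BinCode n} (L : IsZ2Z2uLinear C α β) →
                          ∀ {v} → C (unpermute (proj₁ L) v) → C (unpermute (proj₁ L) (swap α β v))
Z2Z2uLinear⇒swap-closed {α = α} {β} {C} (σ , 𝒞 , 𝒞-additive , C⇔) {v} v∈
  with Equivalence.to (C⇔ (unpermute σ v)) v∈
... | y , y∈ , Ψy≡ = Equivalence.from (C⇔ (unpermute σ (swap α β v)))
  (𝟙+𝕦 ⊙ y , IsAdditive.closed-· 𝒞-additive 𝟙+𝕦 y∈ , eq)
  where
  eq : Ψ (𝟙+𝕦 ⊙ y) ≡ permute σ (unpermute σ (swap α β v))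
  eq = begin
    Ψ (𝟙+𝕦 ⊙ y)                              ≡⟨ Ψ-𝟙+𝕦 y ⟩
    swap α β (Ψ y)                           ≡⟨ cong (swap α β) (trans Ψy≡ (permute-unpermute σ v)) ⟩
    swap α β v                               ≡⟨ permute-unpermute σ (swap α β v) ⟨
    permute σ (unpermute σ (swap α β v))     ∎
    where open ≡-Reasoning

conjugateSwap-⊻ : ∀ α β (σ : Fin (α + β * 2) ↔ Fin n) → Additive (conjugateSwap α β σ)
conjugateSwap-⊻ α β σ u v = begin
  unpermute σ (swap α β (permute σ (u ⊻ v)))
    ≡⟨ cong (unpermute σ ∘ swap α β) (permute-⊻ σ u v) ⟩
  unpermute σ (swap α β (permute σ u ⊻ permute σ v))
    ≡⟨ cong (unpermute σ) (swap-⊻ α β (permute σ u) (permute σ v)) ⟩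
  unpermute σ (swap α β (permute σ u) ⊻ swap α β (permute σ v))
    ≡⟨ permute-⊻ (↔-sym σ) (swap α β (permute σ u)) (swap α β (permute σ v)) ⟩
  conjugateSwap α β σ u ⊻ conjugateSwap α β σ v
    ∎
  where open ≡-Reasoning

spanned-swap-closed⇒Z2Z2uLinear : {C : BinCode n} (R : Vec (Vec Bool n) k) (σ : Fin (α + β * 2) ↔ Fin n) →
                                  IsLinearCode C → (∀ {c} → C c → Span R c) →
                                  (∀ i → C (conjugateSwap α β σ (lookup R i))) → IsZ2Z2uLinear C α β
spanned-swap-closed⇒Z2Z2uLinear {α = α} {β} {C} R σ C-linear C⊆span R-swap∈ =
  swap-closed⇒Z2Z2uLinear σ C-linear λ c∈ →
    let m , encode≡c = C⊆span c∈
    in subst (C ∘ conjugateSwap α β σ) encode≡c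
             (IsLinearCode.additive-closed C-linear (conjugateSwap-⊻ α β σ) R R-swap∈ m)

-- Swap-invariant codes with the parameters of G₂₄

record SwapInvariantGolayLike (α β : ℕ) (D : Vec Bool (α + β * 2) → Set) : Set where
  field
    length≡24       : α + β * 2 ≡ 24
    linear          : IsLinearCode D
    self-orthogonal : ∀ {u v} → D u → D v → dot u v ≡ false
    weight∈         : ∀ {v} → D v → wt v ∈ golayWeights
    generator       : Fin 12 → Vec Bool (α + β * 2)
    generator∈      : ∀ i → D (generator i)
    dual⊆           : ∀ x → (∀ i → dot x (generator i) ≡ false) → D x
    swap-closed     : ∀ {v} → D v → D (swap α β v)

Admissible : Vec Bool β → Set
Admissible a = wt (double a) ∈ golayWeights

admissible? : (a : Vec Bool β) → Dec (Admissible a)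
admissible? a = wt (double a) ∈? golayWeights

module SwapInvariantGolayLikeProperties {α β} {D : Vec Bool (α + β * 2) → Set}
                                        (G : SwapInvariantGolayLike α β D) where
  open SwapInvariantGolayLike G
  open IsLinearCode linear

  Residue : Vec Bool β → Set
  Residue a = ∃₂ λ x w → D (x ++ w) × residue β w ≡ a

  residue-admissible : ∀ {a} → Residue a → Admissible a
  residue-admissible (x , w , x++w∈ , refl) =
    subst (_∈ golayWeights) wt≡ (weight∈ (⊻-closed x++w∈ (swap-closed x++w∈)))
    where
    wt≡ : wt ((x ++ w) ⊻ swap α β (x ++ w)) ≡ wt (double (residue β w))
    wt≡ = trans (cong wt (⊻-swap x w)) (wt-𝟎++ {m = α} (double (residue β w)))

  residue-⊻-closed : ∀ {a b} → Residue a → Residue b → Residue (a ⊻ b)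
  residue-⊻-closed (x , w , x++w∈ , refl) (x′ , w′ , x′++w′∈ , refl) =
    x ⊻ x′ , w ⊻ w′ , subst D (++-⊻ x w x′ w′) (⊻-closed x++w∈ x′++w′∈) , residue-⊻ {β} w w′

  -- 𝟎 ++ double v has a non-Golay weight, so it is not in D = D⊥ and meets some generator.
  residue-witness : ∀ v → ¬ Admissible v → ∃ λ a → Residue a × dot v a ≡ true
  residue-witness v v-inadmissible
    with Finₚ.¬∀⟶∃¬ 12 _ (λ i → dot (𝟎 {α} ++ double v) (generator i) Boolₚ.≟ false) ¬U⊥
    where
    U∈⇒admissible : D (𝟎 {α} ++ double v) → Admissible v
    U∈⇒admissible U∈ = subst (_∈ golayWeights) (wt-𝟎++ {m = α} (double v)) (weight∈ U∈)
    ¬U⊥ : ¬ (∀ i → dot (𝟎 {α} ++ double v) (generator i) ≡ false)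
    ¬U⊥ U⊥ = v-inadmissible (U∈⇒admissible (dual⊆ _ U⊥))
  ... | i , U·gᵢ≢false with Vec.splitAt α (generator i)
  ...   | x , w , gᵢ≡ = residue β w , (x , w , subst D gᵢ≡ (generator∈ i) , refl) , v·a≡true
    where
    v·a≡true : dot v (residue β w) ≡ true
    v·a≡true = begin
      dot v (residue β w)                   ≡⟨ dot-double v w ⟨
      dot (double v) w                      ≡⟨ cong (_xor dot (double v) w) (dot-𝟎ˡ x) ⟨
      dot 𝟎 x xor dot (double v) w          ≡⟨ dot-++ 𝟎 (double v) x w ⟨
      dot (𝟎 ++ double v) (x ++ w)          ≡⟨ cong (dot (𝟎 ++ double v)) gᵢ≡ ⟨
      dot (𝟎 ++ double v) (generator i)     ≡⟨ Boolₚ.¬-not U·gᵢ≢false ⟩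
      true                                  ∎
      where open ≡-Reasoning

  α∈ : α ∈ golayWeights
  α∈ = subst (_∈ golayWeights) wt-F (weight∈ (dual⊆ F F⊥))
    where
    F : Vec Bool (α + β * 2)
    F = replicate α true ++ 𝟎
    wt-F : wt F ≡ α
    wt-F = trans (wt-++ (replicate α true) 𝟎)
                 (trans (cong₂ _+_ (wt-ones {α}) (wt-𝟎 {β * 2})) (ℕₚ.+-identityʳ α))
    -- dot F v is the parity of the ℤ₂-part of v, which is also dot v (swap v).
    F⊥ : ∀ i → dot F (generator i) ≡ false
    F⊥ i with Vec.splitAt α (generator i)
    ... | x , w , gᵢ≡ = begin
      dot F (generator i)                  ≡⟨ cong (dot F) gᵢ≡ ⟩
      dot F (x ++ w)                       ≡⟨ dot-++ (replicate α true) 𝟎 x w ⟩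
      dot (replicate α true) x xor dot 𝟎 w ≡⟨ cong₂ _xor_ (dot-ones x) (dot-𝟎ˡ w) ⟩
      parity x xor false                   ≡⟨ Boolₚ.xor-identityʳ (parity x) ⟩
      parity x                             ≡⟨ dot-swap x w ⟨
      dot (x ++ w) (swap α β (x ++ w))     ≡⟨ self-orthogonal x++w∈ (swap-closed x++w∈) ⟩
      false                                ∎
      where
      open ≡-Reasoning
      x++w∈ = subst D gᵢ≡ (generator∈ i)

firstPair : Vec Bool (2 + n)
firstPair = true ∷ true ∷ 𝟎

-- Admissible a ∈ ℤ₂⁴ have weight 0 or 4, so they are all orthogonal to 1100.
admissible⊥firstPair : ∀ a → Admissible a → dot (firstPair {2}) a ≡ false
admissible⊥firstPair = from-yes (all-vec? λ a → admissible? a →-dec (dot (firstPair {2}) a Boolₚ.≟ false))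

-- Admissible a ∈ ℤ₂⁶ have weight 0, 4 or 6.  If a · 110000 = 1 then a has weight 4, so ¬ a
-- has weight 2; an admissible b with (¬ a) · b = 1 has weight 4 and meets a in three places,
-- so a ⊻ b has weight 2.
admissible-complement : ∀ a → Admissible a → dot (firstPair {4}) a ≡ true → ¬ Admissible (map not a)
admissible-complement = from-yes (all-vec? λ a →
  admissible? a →-dec (dot (firstPair {4}) a Boolₚ.≟ true) →-dec ¬? (admissible? (map not a)))

admissible-sum : ∀ a → Admissible a → dot (firstPair {4}) a ≡ true →
                 ∀ b → dot (map not a) b ≡ true → Admissible b → ¬ Admissible (a ⊻ b)
admissible-sum = from-yes (all-vec? λ a →
  admissible? a →-dec (dot (firstPair {4}) a Boolₚ.≟ true) →-dec all-vec? λ b →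
  (dot (map not a) b Boolₚ.≟ true) →-dec admissible? b →-dec ¬? (admissible? (a ⊻ b)))

module _ {α} {D : Vec Bool (α + 4 * 2) → Set} (G : SwapInvariantGolayLike α 4 D) where
  open SwapInvariantGolayLikeProperties G

  swapInvariantGolayLike-β≢4 : ⊥
  swapInvariantGolayLike-β≢4 =
    let a , a∈ , v·a≡true = residue-witness (firstPair {2}) (from-no (admissible? (firstPair {2})))
    in contradiction (trans (sym v·a≡true) (admissible⊥firstPair a (residue-admissible a∈))) λ ()

module _ {α} {D : Vec Bool (α + 6 * 2) → Set} (G : SwapInvariantGolayLike α 6 D) where
  open SwapInvariantGolayLikeProperties G

  swapInvariantGolayLike-β≢6 : ⊥
  swapInvariantGolayLike-β≢6 =
    let a , a∈ , v·a≡true = residue-witness (firstPair {4}) (from-no (admissible? (firstPair {4})))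
        a-admissible      = residue-admissible a∈
        b , b∈ , ¬a·b≡true = residue-witness (map not a) (admissible-complement a a-admissible v·a≡true)
    in admissible-sum a a-admissible v·a≡true b ¬a·b≡true
                      (residue-admissible b∈) (residue-admissible (residue-⊻-closed a∈ b∈))

β-from-length : ∀ α {β} t → α + β * 2 ≡ α + t * 2 → β ≡ t
β-from-length α {β} t eq = ℕₚ.*-cancelʳ-≡ β t 2 (ℕₚ.+-cancelˡ-≡ α _ _ eq)

swapInvariantGolayLike-α : {D : Vec Bool (α + β * 2) → Set} →
                           SwapInvariantGolayLike α β D → 0 < β → α ≡ 0 ⊎ α ≡ 8
swapInvariantGolayLike-α {β = β} G 0<β with SwapInvariantGolayLikeProperties.α∈ G
... | here refl                          = inj₁ refl
... | there (here refl)                  = inj₂ refl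
... | there (there (here refl))
  with refl ← β-from-length 12 {β} 6 (SwapInvariantGolayLike.length≡24 G) =
    ⊥-elim (swapInvariantGolayLike-β≢6 G)
... | there (there (there (here refl)))
  with refl ← β-from-length 16 {β} 4 (SwapInvariantGolayLike.length≡24 G) =
    ⊥-elim (swapInvariantGolayLike-β≢4 G)
... | there (there (there (there (here refl))))
  with refl ← β-from-length 24 {β} 0 (SwapInvariantGolayLike.length≡24 G) = contradiction 0<β λ ()

record Isometry (m n : ℕ) : Set where
  field
    to      : Vec Bool m → Vec Bool n
    from    : Vec Bool n → Vec Bool m
    to-from : ∀ r → to (from r) ≡ r
    to-⊻    : Additive to
    wt-to   : ∀ v → wt (to v) ≡ wt v
    dot-to  : ∀ u v → dot (to u) (to v) ≡ dot u v

permutation-isometry : Fin m ↔ Fin n → Isometry m n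
permutation-isometry σ = record
  { to      = unpermute σ
  ; from    = permute σ
  ; to-from = unpermute-permute σ
  ; to-⊻    = permute-⊻ (↔-sym σ)
  ; wt-to   = wt-permute (↔-sym σ)
  ; dot-to  = dot-permute (↔-sym σ)
  }

rotate-isometry : Isometry m n → Isometry (suc m) (n + 1)
rotate-isometry {m} {n} I = record
  { to      = to′
  ; from    = λ r → lookup (drop n r) Fin.zero ∷ from (take n r)
  ; to-from = to-from′
  ; to-⊻    = λ { (b ∷ u) (b′ ∷ v) →
      trans (cong (_++ _) (to-⊻ u v)) (sym (++-⊻ (to u) (b ∷ []) (to v) (b′ ∷ []))) }
  ; wt-to   = wt-to′
  ; dot-to  = dot-to′
  }
  where
  open Isometry I

  to′ : Vec Bool (suc m) → Vec Bool (n + 1)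
  to′ (b ∷ v) = to v ++ (b ∷ [])

  to-from′ : ∀ r → to′ (lookup (drop n r) Fin.zero ∷ from (take n r)) ≡ r
  to-from′ r with drop n r in eq
  ... | b ∷ [] = trans (cong₂ _++_ (to-from (take n r)) (sym eq)) (Vecₚ.take++drop≡id n r)

  wt-to′ : ∀ v → wt (to′ v) ≡ wt v
  wt-to′ (b ∷ v) = begin
    wt (to v ++ (b ∷ []))   ≡⟨ wt-++ (to v) (b ∷ []) ⟩
    wt (to v) + (bit b + 0) ≡⟨ cong (_+ (bit b + 0)) (wt-to v) ⟩
    wt v + (bit b + 0)      ≡⟨ cong (wt v +_) (ℕₚ.+-identityʳ (bit b)) ⟩
    wt v + bit b            ≡⟨ ℕₚ.+-comm (wt v) (bit b) ⟩
    bit b + wt v            ∎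
    where open ≡-Reasoning

  dot-to′ : ∀ u v → dot (to′ u) (to′ v) ≡ dot u v
  dot-to′ (b ∷ u) (b′ ∷ v) = begin
    dot (to u ++ (b ∷ [])) (to v ++ (b′ ∷ []))   ≡⟨ dot-++ (to u) (b ∷ []) (to v) (b′ ∷ []) ⟩
    dot (to u) (to v) xor ((b ∧ b′) xor false)    ≡⟨ cong₂ _xor_ (dot-to u v) (Boolₚ.xor-identityʳ (b ∧ b′)) ⟩
    dot u v xor (b ∧ b′)                         ≡⟨ Boolₚ.xor-comm (dot u v) (b ∧ b′) ⟩
    (b ∧ b′) xor dot u v                         ∎
    where open ≡-Reasoning

golay24-preimage : (I : Isometry (α + β * 2) 24) → α + β * 2 ≡ 24 →
                   (∀ {v} → G24 (Isometry.to I v) → G24 (Isometry.to I (swap α β v))) →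
                   SwapInvariantGolayLike α β (G24 ∘ Isometry.to I)
golay24-preimage I length≡24 swap-closed = record
  { length≡24       = length≡24
  ; linear          = record
    { 𝟎∈      = subst G24 (sym (additive-𝟎 to-⊻)) 𝟎∈
    ; ⊻-closed = λ {u} {v} u∈ v∈ → subst G24 (sym (to-⊻ u v)) (⊻-closed u∈ v∈)
    }
  ; self-orthogonal = λ {u} {v} u∈ v∈ → trans (sym (dot-to u v)) (golay24-self-orthogonal u∈ v∈)
  ; weight∈         = λ {v} v∈ → subst (_∈ golayWeights) (wt-to v) (golay24-weight v∈)
  ; generator       = λ i → from (lookup golay24Rows i)
  ; generator∈      = λ i → subst G24 (sym (to-from _)) (golay24-row i)
  ; dual⊆           = λ x x⊥ → golay24-complete (to x) λ i →
      trans (cong (dot (to x)) (sym (to-from _))) (trans (dot-to x _) (x⊥ i))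
  ; swap-closed     = swap-closed
  }
  where
  open Isometry I
  open IsLinearCode golay24-linear

length≡24⇒parameters : α + β * 2 ≡ 24 → α ≡ 0 ⊎ α ≡ 8 → (α ≡ 0 × β ≡ 12) ⊎ (α ≡ 8 × β ≡ 8)
length≡24⇒parameters {β = β} length≡ (inj₁ refl) = inj₁ (refl , β-from-length 0 {β} 12 length≡)
length≡24⇒parameters {β = β} length≡ (inj₂ refl) = inj₂ (refl , β-from-length 8 {β} 8 length≡)

length≡23⇒parameters : α + β * 2 ≡ 23 → suc α ≡ 0 ⊎ suc α ≡ 8 → α ≡ 7 × β ≡ 8
length≡23⇒parameters {β = β} length≡ (inj₂ refl) = refl , β-from-length 7 {β} 8 length≡

golay24-Z2Z2uLinear⇒parameters : 0 < β → IsZ2Z2uLinear G24 α β → (α ≡ 0 × β ≡ 12) ⊎ (α ≡ 8 × β ≡ 8)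
golay24-Z2Z2uLinear⇒parameters 0<β L@(σ , _) = length≡24⇒parameters (↔⇒≡ σ) (swapInvariantGolayLike-α
  (golay24-preimage (permutation-isometry σ) (↔⇒≡ σ) (Z2Z2uLinear⇒swap-closed L)) 0<β)

golay23-extension-swap-closed : (L : IsZ2Z2uLinear G23 α β) → ∀ {b v} →
                            G24 (unpermute (proj₁ L) v ++ (b ∷ [])) →
                            G24 (unpermute (proj₁ L) (swap α β v) ++ (b ∷ []))
golay23-extension-swap-closed {α} {β} L@(σ , _) {b} {v} v∈ with golay24-split {unpermute σ v} {b} v∈
... | c∈ , refl = subst (λ p → G24 (unpermute σ (swap α β v) ++ (p ∷ []))) parity≡
                        (unpermute σ (swap α β v) , Z2Z2uLinear⇒swap-closed L c∈ , refl)
  where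
  parity≡ : parity (unpermute σ (swap α β v)) ≡ parity (unpermute σ v)
  parity≡ = trans (parity-permute (↔-sym σ) (swap α β v))
                  (trans (parity-swap α β v) (sym (parity-permute (↔-sym σ) v)))

golay23-Z2Z2uLinear⇒parameters : 0 < β → IsZ2Z2uLinear G23 α β → α ≡ 7 × β ≡ 8
golay23-Z2Z2uLinear⇒parameters 0<β L@(σ , _) = length≡23⇒parameters (↔⇒≡ σ) (swapInvariantGolayLike-α
  (golay24-preimage (rotate-isometry (permutation-isometry σ)) (cong suc (↔⇒≡ σ))
                    λ { {b ∷ v} → golay23-extension-swap-closed L }) 0<β)

InverseTables : Vec (Fin n) m → Vec (Fin m) n → Set
InverseTables t f = (∀ j → lookup t (lookup f j) ≡ j) × (∀ i → lookup f (lookup t i) ≡ i)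

inverseTables? : (t : Vec (Fin n) m) (f : Vec (Fin m) n) → Dec (InverseTables t f)
inverseTables? t f = Finₚ.all? (λ j → lookup t (lookup f j) Finₚ.≟ j)
                 ×-dec Finₚ.all? (λ i → lookup f (lookup t i) Finₚ.≟ i)

tablePermutation : (t : Vec (Fin n) m) (f : Vec (Fin m) n) → {True (inverseTables? t f)} → Fin m ↔ Fin n
tablePermutation t f {inverse} =
  mk↔ₛ′ (lookup t) (lookup f) (proj₁ (toWitness inverse)) (proj₂ (toWitness inverse))

golay24-swap-check? : ∀ α β (σ : Fin (α + β * 2) ↔ Fin 24) →
  Dec (∀ i j → dot (conjugateSwap α β σ (lookup golay24Rows i)) (lookup golay24Rows j) ≡ false)
golay24-swap-check? α β σ = Finₚ.all? λ i → Finₚ.all? λ j →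
  dot (conjugateSwap α β σ (lookup golay24Rows i)) (lookup golay24Rows j) Boolₚ.≟ false

golay24-Z2Z2uLinear-via : (σ : Fin (α + β * 2) ↔ Fin 24) → {True (golay24-swap-check? α β σ)} →
                          IsZ2Z2uLinear G24 α β
golay24-Z2Z2uLinear-via {α} {β} σ {check} =
  spanned-swap-closed⇒Z2Z2uLinear golay24Rows σ golay24-linear golay24⇒span
    λ i → golay24-complete _ (toWitness check i)

golay23-swap-check? : ∀ α β (σ : Fin (α + β * 2) ↔ Fin 23) →
  Dec (∀ i j → dot (extend (conjugateSwap α β σ (lookup golay23Rows i))) (lookup golay24Rows j) ≡ false)
golay23-swap-check? α β σ = Finₚ.all? λ i → Finₚ.all? λ j →
  dot (extend (conjugateSwap α β σ (lookup golay23Rows i))) (lookup golay24Rows j) Boolₚ.≟ false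

golay23-Z2Z2uLinear-via : (σ : Fin (α + β * 2) ↔ Fin 23) → {True (golay23-swap-check? α β σ)} →
                          IsZ2Z2uLinear G23 α β
golay23-Z2Z2uLinear-via {α} {β} σ {check} =
  spanned-swap-closed⇒Z2Z2uLinear golay23Rows σ golay23-linear id
    λ i → proj₁ (golay24-split (golay24-complete _ (toWitness check i)))

golay24-Z2Z2uLinear-0-12 : IsZ2Z2uLinear G24 0 12
golay24-Z2Z2uLinear-0-12 = golay24-Z2Z2uLinear-via (tablePermutation
  (# 0 ∷ # 1 ∷ # 2 ∷ # 3 ∷ # 4 ∷ # 5 ∷ # 6 ∷ # 9 ∷ # 7 ∷ # 17 ∷ # 8 ∷ # 20 ∷
   # 10 ∷ # 23 ∷ # 11 ∷ # 22 ∷ # 12 ∷ # 14 ∷ # 13 ∷ # 15 ∷ # 16 ∷ # 18 ∷ # 19 ∷ # 21 ∷ [])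
  (# 0 ∷ # 1 ∷ # 2 ∷ # 3 ∷ # 4 ∷ # 5 ∷ # 6 ∷ # 8 ∷ # 10 ∷ # 7 ∷ # 12 ∷ # 14 ∷
   # 16 ∷ # 18 ∷ # 17 ∷ # 19 ∷ # 20 ∷ # 9 ∷ # 21 ∷ # 22 ∷ # 11 ∷ # 23 ∷ # 15 ∷ # 13 ∷ []))

-- The ℤ₂-coordinates 0, 1, 2, 3, 5, 14, 17, 23 form an octad.
golay24-Z2Z2uLinear-8-8 : IsZ2Z2uLinear G24 8 8
golay24-Z2Z2uLinear-8-8 = golay24-Z2Z2uLinear-via (tablePermutation
  (# 0 ∷ # 1 ∷ # 2 ∷ # 3 ∷ # 5 ∷ # 14 ∷ # 17 ∷ # 23 ∷ # 4 ∷ # 6 ∷ # 7 ∷ # 22 ∷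
   # 8 ∷ # 20 ∷ # 9 ∷ # 12 ∷ # 10 ∷ # 11 ∷ # 13 ∷ # 19 ∷ # 15 ∷ # 18 ∷ # 16 ∷ # 21 ∷ [])
  (# 0 ∷ # 1 ∷ # 2 ∷ # 3 ∷ # 8 ∷ # 4 ∷ # 9 ∷ # 10 ∷ # 12 ∷ # 14 ∷ # 16 ∷ # 17 ∷
   # 15 ∷ # 18 ∷ # 5 ∷ # 20 ∷ # 22 ∷ # 6 ∷ # 21 ∷ # 19 ∷ # 13 ∷ # 23 ∷ # 11 ∷ # 7 ∷ []))

golay23-Z2Z2uLinear-7-8 : IsZ2Z2uLinear G23 7 8
golay23-Z2Z2uLinear-7-8 = golay23-Z2Z2uLinear-via (tablePermutation
  (# 0 ∷ # 1 ∷ # 2 ∷ # 3 ∷ # 5 ∷ # 14 ∷ # 17 ∷ # 4 ∷ # 6 ∷ # 7 ∷ # 22 ∷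
   # 8 ∷ # 20 ∷ # 9 ∷ # 12 ∷ # 10 ∷ # 11 ∷ # 13 ∷ # 19 ∷ # 15 ∷ # 18 ∷ # 16 ∷ # 21 ∷ [])
  (# 0 ∷ # 1 ∷ # 2 ∷ # 3 ∷ # 7 ∷ # 4 ∷ # 8 ∷ # 9 ∷ # 11 ∷ # 13 ∷ # 15 ∷ # 16 ∷
   # 14 ∷ # 17 ∷ # 5 ∷ # 19 ∷ # 21 ∷ # 6 ∷ # 20 ∷ # 18 ∷ # 12 ∷ # 22 ∷ # 10 ∷ []))

theorem2 : (IsZ2Z2uLinear G24 0 12 × IsZ2Z2uLinear G24 8 8 × IsZ2Z2uLinear G23 7 8)
    × (∀ (α β : ℕ) → 0 < β → IsZ2Z2uLinear G24 α β → (α ≡ 0 × β ≡ 12) ⊎ (α ≡ 8 × β ≡ 8))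
    × (∀ (α β : ℕ) → 0 < β → IsZ2Z2uLinear G23 α β → α ≡ 7 × β ≡ 8)
theorem2 = (golay24-Z2Z2uLinear-0-12 , golay24-Z2Z2uLinear-8-8 , golay23-Z2Z2uLinear-7-8)
         , (λ α β → golay24-Z2Z2uLinear⇒parameters)
         , (λ α β → golay23-Z2Z2uLinear⇒parameters)
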